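{- For any interval graph $G$, the weighted conflict graph $G_c$ is a cocomparability graph.
   Context: Fix an interval representation $\{I_v=[l(v),r(v)]\}_{v\in V(G)}$ of the interval graph $G$ ($uv\in E(G)$ iff $I_u\cap I_v\ne\emptyset$). For a maximal clique $C$ of $G$ and $v,u\in C$, let $C^{lr}(v,u)=\{w\in C: l(w)\ge l(v),\ r(w)\le r(u)\}$. Let $\hat{\mathcal{C}}$ be the collection of all nonempty sets $C^{lr}(v,u)$ over all maximal cliques $C$ and all $v,u\in C$ (it contains all maximal cliques). The weighted conflict graph $G_c$ has vertex set $\hat{\mathcal{C}}$, weight $w(K)=|K|$, and two distinct $K_i,K_j\in\hat{\mathcal{C}}$ are adjacent iff (a) $K_i\cap K_j\neq\emptyset$, or (b) some $x\in K_i$, $y\in K_j$ satisfy $xy\in E(G)$, or (c) some $x\in K_i$, $y\in K_j$ and $z\in V(G)\setminus(K_i\cup K_j)$ satisfy $x,y\in N_G(z)$. A cocomparability graph is a graph whose complement is a comparability graph (equivalently, one admitting a vertex ordering in which for all $i<j<k$ with $ik$ an edge, $ij$ or $jk$ is an edge). -}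

module Defs where

open import Level using (Level; suc; _⊔_)
open import Data.Nat using (ℕ; _≤_)
open import Data.Fin using (Fin)
open import Data.Fin.Subset using (Subset; _∈_; _∉_; _⊆_)
open import Data.Product using (Σ; ∃; ∃-syntax; _×_)
open import Data.Sum using (_⊎_)
open import Relation.Nullary using (¬_)
open import Relation.Binary.PropositionalEquality using (_≡_; _≢_)
open import Function.Bundles using (_⇔_)

-- A graph on an abstract vertex type, given by a vertex predicate V and an
-- adjacency relation E, is a cocomparability graph iff its complement is a
-- comparability graph: there is a strict partial order ≺ on V whose
-- comparable pairs are exactly the non-adjacent pairs of distinct vertices.
IsCocomparability : ∀ {a p e} {A : Set a} (V : A → Set p) (E : A → A → Set e) → Set (suc (a ⊔ p ⊔ e))
IsCocomparability {a} {p} {e} {A} V E =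
  Σ (A → A → Set (a ⊔ p ⊔ e)) λ _≺_ →
      (∀ x → V x → ¬ (x ≺ x))
    × (∀ x y z → V x → V y → V z → x ≺ y → y ≺ z → x ≺ z)
    × (∀ x y → V x → V y → x ≢ y → ((¬ E x y) ⇔ (x ≺ y ⊎ y ≺ x)))

-- Fixed interval representation: vertex v ∈ Fin n has interval [l v , r v].
module _ {n : ℕ} (l r : Fin n → ℕ) where

  Adj : Fin n → Fin n → Set
  Adj u v = u ≢ v × l u ≤ r v × l v ≤ r u

  IsClique : Subset n → Set
  IsClique C = ∀ u v → u ∈ C → v ∈ C → u ≢ v → Adj u v

  IsMaximalClique : Subset n → Set
  IsMaximalClique C = IsClique C × (∀ D → IsClique D → C ⊆ D → D ⊆ C)

  IsClr : Subset n → Fin n → Fin n → Subset n → Set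
  IsClr C v u K = ∀ w → (w ∈ K) ⇔ (w ∈ C × l v ≤ l w × r w ≤ r u)

  InĈ : Subset n → Set
  InĈ K = (∃[ C ] ∃[ v ] ∃[ u ] (IsMaximalClique C × v ∈ C × u ∈ C × IsClr C v u K))
        × (∃[ x ] x ∈ K)

  -- adjacency in the conflict graph G_c (for distinct K₁, K₂)
  ConflictAdj : Subset n → Subset n → Set
  ConflictAdj K₁ K₂ =
      (∃[ x ] (x ∈ K₁ × x ∈ K₂))
    ⊎ (∃[ x ] ∃[ y ] (x ∈ K₁ × y ∈ K₂ × Adj x y))
    ⊎ (∃[ x ] ∃[ y ] ∃[ z ] (x ∈ K₁ × y ∈ K₂ × z ∉ K₁ × z ∉ K₂ × Adj x z × Adj y z))

{-# OPTIONS --safe #-}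
-- Every member of Ĉ is a nonempty clique, i.e. a nonempty set of pairwise
-- intersecting intervals. If two such sets K, K′ are not adjacent in G_c, no
-- interval of one meets an interval of the other; if moreover x₀ ∈ K lies left
-- of y₀ ∈ K′, then every x ∈ K lies left of every y ∈ K′, since otherwise
-- l y₀ ≤ r y < l x ≤ r x₀ < l y₀. Orienting non-adjacent pairs from left to
-- right is transitive because a common neighbour z witnessing an edge of type
-- (c) between the outer sets either lies in the middle set, contradicting the
-- left-to-right arrangement, or witnesses an edge of type (c) with it.
module Submission where

open import Defs
open import Data.Nat using (ℕ; _≤_; _<_)
open import Data.Nat.Properties
  using (≤-trans; <-≤-trans; <⇒≤; <-irrefl; <⇒≱; _≤?_; ≰⇒>; module ≤-Reasoning)
open import Data.Fin using (Fin; _≟_)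
open import Data.Fin.Subset using (Subset; _∈_; Nonempty)
open import Data.Fin.Subset.Properties using (_∈?_)
open import Data.Product using (_×_; _,_; proj₁; proj₂)
open import Data.Sum using (_⊎_; inj₁; inj₂)
open import Data.Empty using (⊥-elim)
open import Relation.Nullary using (¬_; yes; no)
open import Relation.Binary.PropositionalEquality using (refl; _≢_; sym)
open import Function.Bundles using (mk⇔; Equivalence)

module _ {n : ℕ} (l r : Fin n → ℕ) where

  _≪_ : Fin n → Fin n → Set
  x ≪ y = r x < l y

  LeftOf : Subset n → Subset n → Set
  LeftOf K K′ = ∀ x y → x ∈ K → y ∈ K′ → x ≪ y

  Intersecting : Subset n → Set
  Intersecting K = ∀ x y → x ∈ K → y ∈ K → l x ≤ r y

  _≺_ : Subset n → Subset n → Set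
  K ≺ K′ = ¬ ConflictAdj l r K K′ × LeftOf K K′

  Adj-sym : ∀ {x y} → Adj l r x y → Adj l r y x
  Adj-sym (x≢y , lx≤ry , ly≤rx) = (λ y≡x → x≢y (sym y≡x)) , ly≤rx , lx≤ry

  Adj⇒¬≪ : ∀ {x y} → Adj l r x y → ¬ x ≪ y
  Adj⇒¬≪ (_ , _ , ly≤rx) x≪y = <⇒≱ x≪y ly≤rx

  ConflictAdj-sym : ∀ {K K′} → ConflictAdj l r K K′ → ConflictAdj l r K′ K
  ConflictAdj-sym (inj₁ (x , x∈K , x∈K′)) = inj₁ (x , x∈K′ , x∈K)
  ConflictAdj-sym (inj₂ (inj₁ (x , y , x∈K , y∈K′ , adj))) =
    inj₂ (inj₁ (y , x , y∈K′ , x∈K , Adj-sym adj))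
  ConflictAdj-sym (inj₂ (inj₂ (x , y , z , x∈K , y∈K′ , z∉K , z∉K′ , xz , yz))) =
    inj₂ (inj₂ (y , x , z , y∈K′ , x∈K , z∉K′ , z∉K , yz , xz))

  Adj⊎≪⊎≫ : ∀ x y → x ≢ y → Adj l r x y ⊎ x ≪ y ⊎ y ≪ x
  Adj⊎≪⊎≫ x y x≢y with l y ≤? r x | l x ≤? r y
  ... | no ly≰rx | _          = inj₂ (inj₁ (≰⇒> ly≰rx))
  ... | yes _    | no lx≰ry   = inj₂ (inj₂ (≰⇒> lx≰ry))
  ... | yes ly≤rx | yes lx≤ry = inj₁ (x≢y , lx≤ry , ly≤rx)

  ¬ConflictAdj⇒separated : ∀ {K K′ x y} → ¬ ConflictAdj l r K K′ →
                           x ∈ K → y ∈ K′ → x ≪ y ⊎ y ≪ x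
  ¬ConflictAdj⇒separated {x = x} {y} noConflict x∈K y∈K′ with x ≟ y
  ... | yes refl = ⊥-elim (noConflict (inj₁ (x , x∈K , y∈K′)))
  ... | no x≢y with Adj⊎≪⊎≫ x y x≢y
  ...   | inj₁ adj = ⊥-elim (noConflict (inj₂ (inj₁ (x , y , x∈K , y∈K′ , adj))))
  ...   | inj₂ sep = sep

  ¬ConflictAdj⇒LeftOf : ∀ {K K′ x₀ y₀} → Intersecting K → Intersecting K′ →
                        ¬ ConflictAdj l r K K′ → x₀ ∈ K → y₀ ∈ K′ → x₀ ≪ y₀ →
                        LeftOf K K′
  ¬ConflictAdj⇒LeftOf {x₀ = x₀} {y₀} ∩K ∩K′ noConflict x₀∈K y₀∈K′ x₀≪y₀ x y x∈K y∈K′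
    with ¬ConflictAdj⇒separated noConflict x∈K y∈K′
  ... | inj₁ x≪y = x≪y
  ... | inj₂ y≪x = ⊥-elim (<-irrefl refl ly₀<ly₀)
    where
    open ≤-Reasoning
    ly₀<ly₀ : l y₀ < l y₀
    ly₀<ly₀ = begin-strict
      l y₀ ≤⟨ ∩K′ y₀ y y₀∈K′ y∈K′ ⟩
      r y  <⟨ y≪x ⟩
      l x  ≤⟨ ∩K x x₀ x∈K x₀∈K ⟩
      r x₀ <⟨ x₀≪y₀ ⟩
      l y₀ ∎

  ≺-connex : ∀ {K K′} → Nonempty K → Nonempty K′ → Intersecting K → Intersecting K′ →
             ¬ ConflictAdj l r K K′ → K ≺ K′ ⊎ K′ ≺ K
  ≺-connex {K} {K′} (x₀ , x₀∈K) (y₀ , y₀∈K′) ∩K ∩K′ noConflict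
    with ¬ConflictAdj⇒separated noConflict x₀∈K y₀∈K′
  ... | inj₁ x₀≪y₀ = inj₁ (noConflict , ¬ConflictAdj⇒LeftOf ∩K ∩K′ noConflict x₀∈K y₀∈K′ x₀≪y₀)
  ... | inj₂ y₀≪x₀ = inj₂ (noConflict′ , ¬ConflictAdj⇒LeftOf ∩K′ ∩K noConflict′ y₀∈K′ x₀∈K y₀≪x₀)
    where
    noConflict′ : ¬ ConflictAdj l r K′ K
    noConflict′ c = noConflict (ConflictAdj-sym c)

  module _ (l≤r : ∀ v → l v ≤ r v) where

    ≪-irrefl : ∀ x → ¬ x ≪ x
    ≪-irrefl x x≪x = <⇒≱ x≪x (l≤r x)

    ≪-trans : ∀ {x y z} → x ≪ y → y ≪ z → x ≪ z
    ≪-trans {y = y} x≪y y≪z = <-≤-trans x≪y (≤-trans (l≤r y) (<⇒≤ y≪z))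

    ≺-irrefl : ∀ {K} → Nonempty K → ¬ K ≺ K
    ≺-irrefl (x , x∈K) (_ , K≪K) = ≪-irrefl x (K≪K x x x∈K x∈K)

    ≺-trans : ∀ {K₁ K₂ K₃} → Nonempty K₂ → K₁ ≺ K₂ → K₂ ≺ K₃ → K₁ ≺ K₃
    ≺-trans {K₁} {K₂} {K₃} (y , y∈K₂) (noConflict₁₂ , K₁≪K₂) (_ , K₂≪K₃) =
      noConflict₁₃ , K₁≪K₃
      where
      K₁≪K₃ : LeftOf K₁ K₃
      K₁≪K₃ x z x∈K₁ z∈K₃ = ≪-trans (K₁≪K₂ x y x∈K₁ y∈K₂) (K₂≪K₃ y z y∈K₂ z∈K₃)

      noConflict₁₃ : ¬ ConflictAdj l r K₁ K₃
      noConflict₁₃ (inj₁ (x , x∈K₁ , x∈K₃)) = ≪-irrefl x (K₁≪K₃ x x x∈K₁ x∈K₃)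
      noConflict₁₃ (inj₂ (inj₁ (x , z , x∈K₁ , z∈K₃ , xz))) =
        Adj⇒¬≪ xz (K₁≪K₃ x z x∈K₁ z∈K₃)
      noConflict₁₃ (inj₂ (inj₂ (x , z , w , x∈K₁ , z∈K₃ , w∉K₁ , _ , xw@(_ , _ , lw≤rx) , (_ , lz≤rw , _))))
        with w ∈? K₂
      ... | yes w∈K₂ = Adj⇒¬≪ xw (K₁≪K₂ x w x∈K₁ w∈K₂)
      ... | no w∉K₂ =
        noConflict₁₂ (inj₂ (inj₂ (x , y , w , x∈K₁ , y∈K₂ , w∉K₁ , w∉K₂ , xw , yw)))
        where
        yw : Adj l r y w
        yw = (λ { refl → w∉K₂ y∈K₂ })
           , ≤-trans (l≤r y) (≤-trans (<⇒≤ (K₂≪K₃ y z y∈K₂ z∈K₃)) lz≤rw)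
           , ≤-trans lw≤rx (≤-trans (<⇒≤ (K₁≪K₂ x y x∈K₁ y∈K₂)) (l≤r y))

    intersecting-family-cocomparability :
      (P : Subset n → Set) → (∀ {K} → P K → Nonempty K × Intersecting K) →
      IsCocomparability P (ConflictAdj l r)
    intersecting-family-cocomparability P P⇒∩ =
        _≺_
      , (λ K PK → ≺-irrefl (proj₁ (P⇒∩ PK)))
      , (λ _ _ _ _ PK₂ _ → ≺-trans (proj₁ (P⇒∩ PK₂)))
      , λ K K′ PK PK′ _ → mk⇔
          (≺-connex (proj₁ (P⇒∩ PK)) (proj₁ (P⇒∩ PK′)) (proj₂ (P⇒∩ PK)) (proj₂ (P⇒∩ PK′)))
          (λ { (inj₁ (noConflict , _)) → noConflict
             ; (inj₂ (noConflict , _)) c → noConflict (ConflictAdj-sym c) })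

    InĈ⇒Intersecting : ∀ {K} → InĈ l r K → Intersecting K
    InĈ⇒Intersecting {K} ((C , _ , _ , (isClique , _) , _ , _ , K≡Clr) , _) x y x∈K y∈K
      with x ≟ y
    ... | yes refl = l≤r x
    ... | no x≢y = proj₁ (proj₂ (isClique x y (K⊆C x∈K) (K⊆C y∈K) x≢y))
      where
      K⊆C : ∀ {w} → w ∈ K → w ∈ C
      K⊆C {w} w∈K = proj₁ (Equivalence.to (K≡Clr w) w∈K)

lemma7 : (n : ℕ) (l r : Fin n → ℕ) → (∀ v → l v ≤ r v) →
    IsCocomparability (InĈ l r) (ConflictAdj l r)
lemma7 n l r l≤r =
  intersecting-family-cocomparability l r l≤r (InĈ l r)
    (λ K∈Ĉ → proj₂ K∈Ĉ , InĈ⇒Intersecting l r l≤r K∈Ĉ)
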